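{- Let $\mathcal{C}$ be a category equipped with an object extension structure $X$. For every $q$-morphism structure $Z$ over $X$ there is a term-structure over $X$ that is compatible with $Z$.
   Context: Composition is written diagrammatically ($f;g$ for $f$ then $g$); for a presheaf $P$, $f^*x=P(f)(x)$; $y$ is the Yoneda embedding, $\bar x$ the Yoneda transpose. An object extension structure on $\mathcal{C}$ consists of a presheaf $\mathrm{Ty}:\mathcal{C}^{op}\to\mathbf{Set}$ and, for each object $\Gamma$ and $A\in\mathrm{Ty}(\Gamma)$, an object $\Gamma.A$ and a morphism $\pi_A:\Gamma.A\to\Gamma$. A term-structure over it consists of a presheaf $\mathrm{Tm}$, a natural transformation $p:\mathrm{Tm}\to\mathrm{Ty}$, and for each $\Gamma$, $A\in\mathrm{Ty}(\Gamma)$ an element $\mathrm{te}_A\in\mathrm{Tm}(\Gamma.A)$ with $p(\mathrm{te}_A)=\pi_A^*A$ such that the square $\overline{\mathrm{te}_A}:y(\Gamma.A)\to\mathrm{Tm}$, $y(\pi_A)$, $p$, $\bar A:y(\Gamma)\to\mathrm{Ty}$ is a pullback of presheaves. A $q$-morphism structure over it assigns to each $f:\Gamma'\to\Gamma$ and $A\in\mathrm{Ty}(\Gamma)$ a morphism $q(f,A):\Gamma'.f^*A\to\Gamma.A$ with $q(f,A);\pi_A=\pi_{f^*A};f$ and the resulting square a pullback, such that $q(1_\Gamma,A)$ equals the isomorphism $\Gamma.1_\Gamma^*A\cong\Gamma.A$ induced by the functoriality equality $1_\Gamma^*A=A$, and $q(f';f,A)$ equals the composite of the isomorphism $\Gamma''.(f';f)^*A\cong\Gamma''.f'^*f^*A$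 (induced by the functoriality equality) followed by $q(f',f^*A)$ and then $q(f,A)$. A term-structure and a $q$-morphism structure over $X$ are compatible if for all $f:\Gamma'\to\Gamma$ and $A\in\mathrm{Ty}(\Gamma)$, $\mathrm{te}_{f^*A}=q(f,A)^*\,\mathrm{te}_A$. -}

module Defs where

open import Level using (Level; _⊔_; suc)
open import Data.Product using (Σ; _×_; _,_)
open import Relation.Binary.PropositionalEquality using (_≡_; refl)

-- Categories (hom-sets with propositional equality; K is available, so
-- every type behaves as a set). Composition is diagrammatic: f ⨟ g.
record Category (o ℓ : Level) : Set (suc (o ⊔ ℓ)) where
  infixr 9 _⨟_
  field
    Ob    : Set o
    Hom   : Ob → Ob → Set ℓ
    id    : ∀ {a} → Hom a a
    _⨟_   : ∀ {a b c} → Hom a b → Hom b c → Hom a c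
    idˡ   : ∀ {a b} (f : Hom a b) → id ⨟ f ≡ f
    idʳ   : ∀ {a b} (f : Hom a b) → f ⨟ id ≡ f
    assoc : ∀ {a b c d} (f : Hom a b) (g : Hom b c) (h : Hom c d) →
            (f ⨟ g) ⨟ h ≡ f ⨟ (g ⨟ h)

module _ {o ℓ : Level} (C : Category o ℓ) where
  open Category C

  -- Pullback squares in C:
  --     P --top--> B
  --     |          |
  --   left       right
  --     v          v
  --     A --bot--> D
  record IsPullback {P A B D : Ob} (top : Hom P B) (left : Hom P A)
                    (right : Hom B D) (bot : Hom A D) : Set (o ⊔ ℓ) where
    field
      commutes  : top ⨟ right ≡ left ⨟ bot
      universal : ∀ {W} (h : Hom W B) (g : Hom W A) → h ⨟ right ≡ g ⨟ bot →
                  Σ (Hom W P) (λ k → (k ⨟ top ≡ h) × (k ⨟ left ≡ g)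
                     × (∀ (k' : Hom W P) → k' ⨟ top ≡ h → k' ⨟ left ≡ g → k' ≡ k))

  record Presheaf : Set (o ⊔ suc ℓ) where
    field
      F₀       : Ob → Set ℓ
      act      : ∀ {Δ Γ} → Hom Δ Γ → F₀ Γ → F₀ Δ
      act-id   : ∀ {Γ} (x : F₀ Γ) → act id x ≡ x
      act-comp : ∀ {Γ'' Γ' Γ} (f' : Hom Γ'' Γ') (f : Hom Γ' Γ) (x : F₀ Γ) →
                 act (f' ⨟ f) x ≡ act f' (act f x)

  open Presheaf

  record NatTrans (P Q : Presheaf) : Set (o ⊔ ℓ) where
    field
      η   : ∀ Γ → F₀ P Γ → F₀ Q Γ
      nat : ∀ {Δ Γ} (f : Hom Δ Γ) (x : F₀ P Γ) →
            η Δ (act P f x) ≡ act Q f (η Γ x)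

  open NatTrans

  _⨟ₙ_ : ∀ {P Q R} → NatTrans P Q → NatTrans Q R → NatTrans P R
  _⨟ₙ_ {P} {Q} {R} α β = record
    { η = λ Γ x → η β Γ (η α Γ x)
    ; nat = λ {Δ} {Γ} f x → trans' (cong' (η β Δ) (nat α f x)) (nat β f (η α Γ x)) }
    where
      trans' : ∀ {A : Set ℓ} {x y z : A} → x ≡ y → y ≡ z → x ≡ z
      trans' refl q = q
      cong' : ∀ {A B : Set ℓ} (h : A → B) {x y : A} → x ≡ y → h x ≡ h y
      cong' h refl = refl

  _≈ₙ_ : ∀ {P Q} → NatTrans P Q → NatTrans P Q → Set (o ⊔ ℓ)
  _≈ₙ_ {P} α β = ∀ Γ (x : F₀ P Γ) → η α Γ x ≡ η β Γ x

  y : Ob → Presheaf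
  y Γ = record
    { F₀ = λ Δ → Hom Δ Γ
    ; act = λ f g → f ⨟ g
    ; act-id = λ g → idˡ g
    ; act-comp = λ f' f g → assoc f' f g }

  y₁ : ∀ {Γ' Γ} → Hom Γ' Γ → NatTrans (y Γ') (y Γ)
  y₁ h = record { η = λ Δ g → g ⨟ h ; nat = λ f g → assoc f g h }

  transpose : (P : Presheaf) {Γ : Ob} → F₀ P Γ → NatTrans (y Γ) P
  transpose P x = record { η = λ Δ f → act P f x ; nat = λ f g → act-comp P f g x }

  record IsPullbackPSh {P A B D : Presheaf} (top : NatTrans P B) (left : NatTrans P A)
                       (right : NatTrans B D) (bot : NatTrans A D) : Set (o ⊔ suc ℓ) where
    field
      commutes  : (top ⨟ₙ right) ≈ₙ (left ⨟ₙ bot)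
      universal : ∀ (W : Presheaf) (h : NatTrans W B) (g : NatTrans W A) →
                  (h ⨟ₙ right) ≈ₙ (g ⨟ₙ bot) →
                  Σ (NatTrans W P) (λ k → ((k ⨟ₙ top) ≈ₙ h) × ((k ⨟ₙ left) ≈ₙ g)
                     × (∀ (k' : NatTrans W P) → (k' ⨟ₙ top) ≈ₙ h → (k' ⨟ₙ left) ≈ₙ g →
                          k' ≈ₙ k))

  record ObjExt : Set (o ⊔ suc ℓ) where
    field
      Ty  : Presheaf
      _∙_ : (Γ : Ob) → F₀ Ty Γ → Ob
      π   : ∀ {Γ} (A : F₀ Ty Γ) → Hom (Γ ∙ A) Γ

module _ {o ℓ : Level} {C : Category o ℓ} (X : ObjExt C) where
  open Category C
  open Presheaf
  open NatTrans
  open ObjExt X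

  extEq : ∀ {Γ} {A B : F₀ Ty Γ} → A ≡ B → Hom (Γ ∙ A) (Γ ∙ B)
  extEq refl = id

  record TermStructure : Set (o ⊔ suc ℓ) where
    field
      Tm   : Presheaf C
      p    : NatTrans C Tm Ty
      te   : ∀ {Γ} (A : F₀ Ty Γ) → F₀ Tm (Γ ∙ A)
      p-te : ∀ {Γ} (A : F₀ Ty Γ) → η p (Γ ∙ A) (te A) ≡ act Ty (π A) A
      pb   : ∀ {Γ} (A : F₀ Ty Γ) →
             IsPullbackPSh C (transpose C Tm (te A)) (y₁ C (π A)) p (transpose C Ty A)

  record QMorphStructure : Set (o ⊔ ℓ) where
    field
      q      : ∀ {Γ' Γ} (f : Hom Γ' Γ) (A : F₀ Ty Γ) → Hom (Γ' ∙ act Ty f A) (Γ ∙ A)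
      q-sq   : ∀ {Γ' Γ} (f : Hom Γ' Γ) (A : F₀ Ty Γ) →
               q f A ⨟ π A ≡ π (act Ty f A) ⨟ f
      q-pb   : ∀ {Γ' Γ} (f : Hom Γ' Γ) (A : F₀ Ty Γ) →
               IsPullback C (q f A) (π (act Ty f A)) (π A) f
      q-id   : ∀ {Γ} (A : F₀ Ty Γ) → q id A ≡ extEq (act-id Ty A)
      q-comp : ∀ {Γ'' Γ' Γ} (f' : Hom Γ'' Γ') (f : Hom Γ' Γ) (A : F₀ Ty Γ) →
               q (f' ⨟ f) A ≡ extEq (act-comp Ty f' f A) ⨟ (q f' (act Ty f A) ⨟ q f A)

  Compatible : TermStructure → QMorphStructure → Set (o ⊔ ℓ)
  Compatible T Z =
    ∀ {Γ' Γ} (f : Hom Γ' Γ) (A : F₀ Ty Γ) →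
      te (act Ty f A) ≡ act Tm (q f A) (te A)
    where
      open TermStructure T
      open QMorphStructure Z

-- Take a term of type A in context Γ to be a section of π_A. Since the
-- q-squares are pullbacks, maps Δ → Γ.A lying over G : Δ → Γ correspond
-- bijectively to sections of π_{G*A}. This correspondence yields the
-- reindexing of terms, the generic term te_A (the diagonal, corresponding to
-- the identity of Γ.A), and, pointwise in Δ, the pullback property of the
-- square for te_A. Compatibility holds because te_{f*A} corresponds to q(f,A).
module Submission where

open import Defs
open import Level using (Level; _⊔_)
open import Data.Product using (Σ; _,_; proj₁; proj₂; _×_)
open import Relation.Binary.PropositionalEquality
open import Axiom.UniquenessOfIdentityProofs.WithK using (uip)

module IsPullbackProperties {o ℓ : Level} {C : Category o ℓ} where
  open Category C
  open ≡-Reasoning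

  module _ {P A B D : Ob} {top : Hom P B} {left : Hom P A} {right : Hom B D} {bot : Hom A D}
           (pb : IsPullback C top left right bot) where
    open IsPullback pb

    jointly-monic : ∀ {W} (k₁ k₂ : Hom W P) →
                    k₁ ⨟ top ≡ k₂ ⨟ top → k₁ ⨟ left ≡ k₂ ⨟ left → k₁ ≡ k₂
    jointly-monic k₁ k₂ t≡ l≡ =
      trans (mediator-unique k₁ refl refl) (sym (mediator-unique k₂ (sym t≡) (sym l≡)))
      where
        k₁-commutes : (k₁ ⨟ top) ⨟ right ≡ (k₁ ⨟ left) ⨟ bot
        k₁-commutes = begin
          (k₁ ⨟ top) ⨟ right  ≡⟨ assoc _ _ _ ⟩
          k₁ ⨟ (top ⨟ right)  ≡⟨ cong (k₁ ⨟_) commutes ⟩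
          k₁ ⨟ (left ⨟ bot)   ≡⟨ sym (assoc _ _ _) ⟩
          (k₁ ⨟ left) ⨟ bot   ∎

        mediator-unique : ∀ k → k ⨟ top ≡ k₁ ⨟ top → k ⨟ left ≡ k₁ ⨟ left →
                          k ≡ proj₁ (universal (k₁ ⨟ top) (k₁ ⨟ left) k₁-commutes)
        mediator-unique = proj₂ (proj₂ (proj₂ (universal (k₁ ⨟ top) (k₁ ⨟ left) k₁-commutes)))

    private
      over-id : ∀ {a : Hom A B} → a ⨟ right ≡ bot → a ⨟ right ≡ id ⨟ bot
      over-id e = trans e (sym (idˡ bot))

    section : (a : Hom A B) → a ⨟ right ≡ bot → Hom A P
    section a e = proj₁ (universal a id (over-id e))

    section-top : (a : Hom A B) (e : a ⨟ right ≡ bot) → section a e ⨟ top ≡ a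
    section-top a e = proj₁ (proj₂ (universal a id (over-id e)))

    section-left : (a : Hom A B) (e : a ⨟ right ≡ bot) → section a e ⨟ left ≡ id
    section-left a e = proj₁ (proj₂ (proj₂ (universal a id (over-id e))))

module _ {o ℓ : Level} {C : Category o ℓ} where
  open Category C using (Hom)
  open Presheaf
  open NatTrans

  module _ {P A B D : Presheaf C} (top : NatTrans C P B) (left : NatTrans C P A)
           (right : NatTrans C B D) (bot : NatTrans C A D) where

    Gluing : ∀ Δ → F₀ B Δ → F₀ A Δ → Set ℓ
    Gluing Δ b a = Σ (F₀ P Δ) λ x → (η top Δ x ≡ b) × (η left Δ x ≡ a)
                     × (∀ x' → η top Δ x' ≡ b → η left Δ x' ≡ a → x' ≡ x)

    PointwiseGluing : Set (o ⊔ ℓ)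
    PointwiseGluing = ∀ Δ b a → η right Δ b ≡ η bot Δ a → Gluing Δ b a

  module _ {P A B D : Presheaf C} {top : NatTrans C P B} {left : NatTrans C P A}
           {right : NatTrans C B D} {bot : NatTrans C A D} where

    pointwise⇒isPullbackPSh : (∀ Δ x → η right Δ (η top Δ x) ≡ η bot Δ (η left Δ x)) →
                              PointwiseGluing top left right bot → IsPullbackPSh C top left right bot
    pointwise⇒isPullbackPSh commutes glue = record { commutes = commutes ; universal = universal }
      where
        module _ (W : Presheaf C) (h : NatTrans C W B) (g : NatTrans C W A)
                 (h≡g : ∀ Δ w → η right Δ (η h Δ w) ≡ η bot Δ (η g Δ w)) where
          glued : ∀ Δ w → Gluing top left right bot Δ (η h Δ w) (η g Δ w)
          glued Δ w = glue Δ (η h Δ w) (η g Δ w) (h≡g Δ w)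

          glued-top : ∀ Δ w → η top Δ (proj₁ (glued Δ w)) ≡ η h Δ w
          glued-top Δ w = proj₁ (proj₂ (glued Δ w))

          glued-left : ∀ Δ w → η left Δ (proj₁ (glued Δ w)) ≡ η g Δ w
          glued-left Δ w = proj₁ (proj₂ (proj₂ (glued Δ w)))

          glued-unique : ∀ Δ w x' → η top Δ x' ≡ η h Δ w → η left Δ x' ≡ η g Δ w →
                         x' ≡ proj₁ (glued Δ w)
          glued-unique Δ w = proj₂ (proj₂ (proj₂ (glued Δ w)))

          glued-nat : ∀ {Δ Γ} (f : Hom Δ Γ) (w : F₀ W Γ) →
                      proj₁ (glued Δ (act W f w)) ≡ act P f (proj₁ (glued Γ w))
          glued-nat f w = sym (glued-unique _ (act W f w) _
            (trans (nat top f _) (trans (cong (act B f) (glued-top _ w)) (sym (nat h f w))))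
            (trans (nat left f _) (trans (cong (act A f) (glued-left _ w)) (sym (nat g f w)))))

          mediator : NatTrans C W P
          mediator = record { η = λ Δ w → proj₁ (glued Δ w) ; nat = glued-nat }

          universal : Σ (NatTrans C W P) λ k →
                        (_≈ₙ_ C (_⨟ₙ_ C k top) h) × (_≈ₙ_ C (_⨟ₙ_ C k left) g)
                        × (∀ k' → _≈ₙ_ C (_⨟ₙ_ C k' top) h → _≈ₙ_ C (_⨟ₙ_ C k' left) g →
                                  _≈ₙ_ C k' k)
          universal = mediator , glued-top , glued-left ,
                      λ k t≡ l≡ Δ w → glued-unique Δ w (η k Δ w) (t≡ Δ w) (l≡ Δ w)

module TermsFromQMorphisms {o ℓ : Level} {C : Category o ℓ} (X : ObjExt C) (Z : QMorphStructure X) where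
  open Category C
  open Presheaf
  open NatTrans
  open ObjExt X
  open QMorphStructure Z
  open IsPullbackProperties
  open ≡-Reasoning

  record Term (Γ : Ob) : Set ℓ where
    constructor term
    field
      ty    : F₀ Ty Γ
      sec   : Hom Γ (Γ ∙ ty)
      sec-π : sec ⨟ π ty ≡ id

  open Term

  term-≡ : ∀ {Γ} {A : F₀ Ty Γ} {s₁ s₂ : Hom Γ (Γ ∙ A)}
           {p₁ : s₁ ⨟ π A ≡ id} {p₂ : s₂ ⨟ π A ≡ id} →
           s₁ ≡ s₂ → term A s₁ p₁ ≡ term A s₂ p₂
  term-≡ {p₁ = p₁} {p₂} refl = cong (term _ _) (uip p₁ p₂)

  termOf : ∀ {Δ Γ} (A : F₀ Ty Γ) (G : Hom Δ Γ) (a : Hom Δ (Γ ∙ A)) → a ⨟ π A ≡ G → Term Δ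
  termOf A G a e = term (act Ty G A) (section (q-pb G A) a e) (section-left (q-pb G A) a e)

  reindex : ∀ {Δ Γ} → Hom Δ Γ → Term Γ → Term Δ
  reindex f t = termOf (ty t) f (f ⨟ sec t) (trans (assoc _ _ _) (trans (cong (f ⨟_) (sec-π t)) (idʳ f)))

  generic : ∀ {Γ} (A : F₀ Ty Γ) → Term (Γ ∙ A)
  generic A = termOf A (π A) id (idˡ (π A))

  q≡ : ∀ {Δ Γ} (G : Hom Δ Γ) (A : F₀ Ty Γ) {B : F₀ Ty Δ} →
       B ≡ act Ty G A → Hom (Δ ∙ B) (Γ ∙ A)
  q≡ G A refl = q G A

  q≡-π : ∀ {Δ Γ} (G : Hom Δ Γ) (A : F₀ Ty Γ) {B : F₀ Ty Δ} (e : B ≡ act Ty G A) →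
         q≡ G A e ⨟ π A ≡ π B ⨟ G
  q≡-π G A refl = q-sq G A

  q≡-id : ∀ {Γ} (A : F₀ Ty Γ) (e : A ≡ act Ty id A) → q≡ id A e ≡ id
  q≡-id A e = trans (via-extEq e) (cong (extEq X) (uip (trans e (act-id Ty A)) refl))
    where
      via-extEq : ∀ {B} (e : B ≡ act Ty id A) → q≡ id A e ≡ extEq X (trans e (act-id Ty A))
      via-extEq refl = q-id A

  q≡-⨟ : ∀ {Δ' Δ Γ} (g : Hom Δ' Δ) (f : Hom Δ Γ) (A : F₀ Ty Γ) {B : F₀ Ty Δ'}
         (e : B ≡ act Ty (g ⨟ f) A) (e' : B ≡ act Ty g (act Ty f A)) →
         q≡ (g ⨟ f) A e ≡ q≡ g (act Ty f A) e' ⨟ q f A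
  q≡-⨟ {Δ'} {Γ = Γ} g f A e refl = begin
    q≡ (g ⨟ f) A e                                    ≡⟨ via-extEq e ⟩
    extEq X (trans e (act-comp Ty g f A)) ⨟ q-then-q
      ≡⟨ cong (λ e′ → extEq X e′ ⨟ q-then-q) (uip (trans e (act-comp Ty g f A)) refl) ⟩
    id ⨟ q-then-q                                     ≡⟨ idˡ _ ⟩
    q-then-q                                          ∎
    where
      q-then-q : Hom (Δ' ∙ act Ty g (act Ty f A)) (Γ ∙ A)
      q-then-q = q g (act Ty f A) ⨟ q f A

      via-extEq : ∀ {B} (e : B ≡ act Ty (g ⨟ f) A) →
                  q≡ (g ⨟ f) A e ≡ extEq X (trans e (act-comp Ty g f A)) ⨟ q-then-q
      via-extEq refl = q-comp g f A

  extend : ∀ {Δ Γ} (A : F₀ Ty Γ) (G : Hom Δ Γ) (t : Term Δ) →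
           ty t ≡ act Ty G A → Hom Δ (Γ ∙ A)
  extend A G t e = sec t ⨟ q≡ G A e

  module _ {Δ Γ : Ob} (A : F₀ Ty Γ) where

    extend-π : ∀ (G : Hom Δ Γ) (t : Term Δ) (e : ty t ≡ act Ty G A) → extend A G t e ⨟ π A ≡ G
    extend-π G t e = begin
      (sec t ⨟ q≡ G A e) ⨟ π A   ≡⟨ assoc _ _ _ ⟩
      sec t ⨟ (q≡ G A e ⨟ π A)   ≡⟨ cong (sec t ⨟_) (q≡-π G A e) ⟩
      sec t ⨟ (π (ty t) ⨟ G)     ≡⟨ sym (assoc _ _ _) ⟩
      (sec t ⨟ π (ty t)) ⨟ G     ≡⟨ cong (_⨟ G) (sec-π t) ⟩
      id ⨟ G                     ≡⟨ idˡ G ⟩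
      G                          ∎

    extend-cong : ∀ {G₁ G₂ : Hom Δ Γ} {t₁ t₂ : Term Δ}
                  {e₁ : ty t₁ ≡ act Ty G₁ A} {e₂ : ty t₂ ≡ act Ty G₂ A} →
                  t₁ ≡ t₂ → G₁ ≡ G₂ → extend A G₁ t₁ e₁ ≡ extend A G₂ t₂ e₂
    extend-cong {G₁} {t₁ = t₁} {e₁ = e₁} {e₂} refl refl = cong (extend A G₁ t₁) (uip e₁ e₂)

    extend-injective : ∀ {G₁ G₂ : Hom Δ Γ} {t₁ t₂ : Term Δ}
                       {e₁ : ty t₁ ≡ act Ty G₁ A} {e₂ : ty t₂ ≡ act Ty G₂ A} →
                       extend A G₁ t₁ e₁ ≡ extend A G₂ t₂ e₂ → t₁ ≡ t₂
    extend-injective {G₁} {G₂} {t₁} {t₂} {e₁} {e₂} t₁≡t₂ =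
      over-equal-bases G₁≡G₂ t₁ t₂ e₁ e₂ t₁≡t₂
      where
        G₁≡G₂ : G₁ ≡ G₂
        G₁≡G₂ = trans (sym (extend-π G₁ t₁ e₁))
                      (trans (cong (_⨟ π A) t₁≡t₂) (extend-π G₂ t₂ e₂))

        over-equal-bases : ∀ {G₁ G₂} → G₁ ≡ G₂ →
                           ∀ t₁ t₂ (e₁ : ty t₁ ≡ act Ty G₁ A) (e₂ : ty t₂ ≡ act Ty G₂ A) →
                           extend A G₁ t₁ e₁ ≡ extend A G₂ t₂ e₂ → t₁ ≡ t₂
        over-equal-bases {G} refl (term _ s₁ p₁) (term _ s₂ p₂) refl refl s₁q≡s₂q =
          term-≡ (jointly-monic (q-pb G A) s₁ s₂ s₁q≡s₂q (trans p₁ (sym p₂)))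

    extend-termOf : ∀ (G : Hom Δ Γ) (a : Hom Δ (Γ ∙ A)) (e : a ⨟ π A ≡ G) →
                    extend A G (termOf A G a e) refl ≡ a
    extend-termOf G a e = section-top (q-pb G A) a e

  extend-⨟ : ∀ {Δ' Δ Γ} (A : F₀ Ty Γ) (g : Hom Δ' Δ) (f : Hom Δ Γ) (t : Term Δ')
             (e : ty t ≡ act Ty (g ⨟ f) A) (e' : ty t ≡ act Ty g (act Ty f A)) →
             extend A (g ⨟ f) t e ≡ extend (act Ty f A) g t e' ⨟ q f A
  extend-⨟ A g f t e e' = trans (cong (sec t ⨟_) (q≡-⨟ g f A e e')) (sym (assoc _ _ _))

  ty-reindex-generic : ∀ {Δ Γ} (A : F₀ Ty Γ) (k : Hom Δ (Γ ∙ A)) →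
                       ty (reindex k (generic A)) ≡ act Ty (k ⨟ π A) A
  ty-reindex-generic A k = sym (act-comp Ty k (π A) A)

  extend-reindex-generic : ∀ {Δ Γ} (A : F₀ Ty Γ) (k : Hom Δ (Γ ∙ A)) →
                           extend A (k ⨟ π A) (reindex k (generic A)) (ty-reindex-generic A k) ≡ k
  extend-reindex-generic A k = begin
    extend A (k ⨟ π A) (reindex k (generic A)) (ty-reindex-generic A k)
      ≡⟨ extend-⨟ A k (π A) (reindex k (generic A)) (ty-reindex-generic A k) refl ⟩
    extend (act Ty (π A) A) k (reindex k (generic A)) refl ⨟ q (π A) A
      ≡⟨ cong (_⨟ q (π A) A) (extend-termOf _ k _ _) ⟩
    (k ⨟ sec (generic A)) ⨟ q (π A) A    ≡⟨ assoc _ _ _ ⟩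
    k ⨟ (sec (generic A) ⨟ q (π A) A)    ≡⟨ cong (k ⨟_) (extend-termOf A (π A) id _) ⟩
    k ⨟ id                               ≡⟨ idʳ k ⟩
    k                                    ∎

  reindex-id : ∀ {Γ} (t : Term Γ) → reindex id t ≡ t
  reindex-id t = extend-injective (ty t) {e₁ = refl} {e₂ = sym (act-id Ty (ty t))} (begin
    extend (ty t) id (reindex id t) refl    ≡⟨ extend-termOf (ty t) id _ _ ⟩
    id ⨟ sec t                              ≡⟨ idˡ _ ⟩
    sec t                                   ≡⟨ sym (idʳ _) ⟩
    sec t ⨟ id
      ≡⟨ cong (sec t ⨟_) (sym (q≡-id (ty t) (sym (act-id Ty (ty t))))) ⟩
    extend (ty t) id t (sym (act-id Ty (ty t))) ∎)

  reindex-⨟ : ∀ {Δ' Δ Γ} (g : Hom Δ' Δ) (f : Hom Δ Γ) (t : Term Γ) →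
              reindex (g ⨟ f) t ≡ reindex g (reindex f t)
  reindex-⨟ g f t = extend-injective (ty t) {e₁ = refl} {e₂ = g*f*≡} (begin
    extend (ty t) (g ⨟ f) (reindex (g ⨟ f) t) refl    ≡⟨ extend-termOf (ty t) (g ⨟ f) _ _ ⟩
    (g ⨟ f) ⨟ sec t                                   ≡⟨ assoc _ _ _ ⟩
    g ⨟ (f ⨟ sec t)                                   ≡⟨ cong (g ⨟_) (sym (extend-termOf (ty t) f _ _)) ⟩
    g ⨟ (sec (reindex f t) ⨟ q f (ty t))              ≡⟨ sym (assoc _ _ _) ⟩
    (g ⨟ sec (reindex f t)) ⨟ q f (ty t)              ≡⟨ cong (_⨟ q f (ty t)) (sym (extend-termOf _ g _ _)) ⟩
    extend (act Ty f (ty t)) g (reindex g (reindex f t)) refl ⨟ q f (ty t)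
      ≡⟨ sym (extend-⨟ (ty t) g f (reindex g (reindex f t)) g*f*≡ refl) ⟩
    extend (ty t) (g ⨟ f) (reindex g (reindex f t)) g*f*≡ ∎)
    where
      g*f*≡ : act Ty g (act Ty f (ty t)) ≡ act Ty (g ⨟ f) (ty t)
      g*f*≡ = sym (act-comp Ty g f (ty t))

  Tm : Presheaf C
  Tm = record { F₀ = Term ; act = reindex ; act-id = reindex-id ; act-comp = reindex-⨟ }

  tyₙ : NatTrans C Tm Ty
  tyₙ = record { η = λ _ → ty ; nat = λ _ _ → refl }

  generic-pullback : ∀ {Γ} (A : F₀ Ty Γ) →
                     IsPullbackPSh C (transpose C Tm (generic A)) (y₁ C (π A)) tyₙ (transpose C Ty A)
  generic-pullback A = pointwise⇒isPullbackPSh (λ _ → ty-reindex-generic A) glue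
    where
      glue : PointwiseGluing (transpose C Tm (generic A)) (y₁ C (π A)) tyₙ (transpose C Ty A)
      glue Δ t G e = extend A G t e
                   , extend-injective A {e₁ = ty-reindex-generic A (extend A G t e)} {e₂ = e}
                       (extend-reindex-generic A (extend A G t e))
                   , extend-π A G t e
                   , λ k k*generic≡t k⨟π≡G →
                       trans (sym (extend-reindex-generic A k))
                             (extend-cong A {e₁ = ty-reindex-generic A k} {e₂ = e} k*generic≡t k⨟π≡G)

  termStructure : TermStructure X
  termStructure = record { Tm = Tm ; p = tyₙ ; te = generic ; p-te = λ _ → refl ; pb = generic-pullback }

  compatible : Compatible X termStructure Z
  compatible f A = extend-injective A {e₁ = π*f*A≡} {e₂ = ty-reindex-generic A (q f A)} (begin
    extend A (π (act Ty f A) ⨟ f) (generic (act Ty f A)) π*f*A≡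
      ≡⟨ extend-⨟ A (π _) f (generic (act Ty f A)) π*f*A≡ refl ⟩
    extend (act Ty f A) (π _) (generic (act Ty f A)) refl ⨟ q f A
      ≡⟨ cong (_⨟ q f A) (extend-termOf _ (π _) id _) ⟩
    id ⨟ q f A   ≡⟨ idˡ _ ⟩
    q f A        ≡⟨ sym (extend-reindex-generic A (q f A)) ⟩
    extend A (q f A ⨟ π A) (reindex (q f A) (generic A)) (ty-reindex-generic A (q f A)) ∎)
    where
      π*f*A≡ : act Ty (π (act Ty f A)) (act Ty f A) ≡ act Ty (π (act Ty f A) ⨟ f) A
      π*f*A≡ = sym (act-comp Ty (π (act Ty f A)) f A)

mainTheorem4 : ∀ {o ℓ : Level} (C : Category o ℓ) (X : ObjExt C) (Z : QMorphStructure X) →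
    Σ (TermStructure X) (λ T → Compatible X T Z)
mainTheorem4 C X Z = termStructure , compatible
  where open TermsFromQMorphisms X Z
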